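{- Let $s,k$ be coprime positive integers with $s\ge 2$. The relation $<_{\mathcal{E}}$ on $\mathcal{E}$ is a (strict) total order: it is irreflexive and any two distinct elements of $\mathcal{E}$ are comparable.
   Context: Let $\mathcal{P}=\mathbb{Z}_{>0}\setminus\{as+b(s+k) : a,b\in\mathbb{Z}_{\ge0}\}$. Let $\mathcal{E}=\mathcal{P}\cap\{1,2,\dots,s+k-1\}$. For $x,y\in\mathcal{E}$ write $x\lessdot_{\mathcal{E}} y$ if $y=x+s$ or $y=x-k$, and let $<_{\mathcal{E}}$ be the transitive closure of $\lessdot_{\mathcal{E}}$. -}

module Defs where

open import Data.Nat using (ℕ; _+_; _*_; _<_)
open import Data.Product using (Σ; ∃; ∃-syntax; _×_)
open import Data.Sum using (_⊎_)
open import Relation.Nullary using (¬_)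
open import Relation.Binary.PropositionalEquality using (_≡_)
open import Relation.Binary.Construct.Closure.Transitive using (TransClosure)

InSemigroup : ℕ → ℕ → ℕ → Set
InSemigroup s k n = ∃[ a ] ∃[ b ] (a * s + b * (s + k) ≡ n)

Inℙ : ℕ → ℕ → ℕ → Set
Inℙ s k n = (0 < n) × ¬ InSemigroup s k n

Inℰ : ℕ → ℕ → ℕ → Set
Inℰ s k n = Inℙ s k n × (n < s + k)

-- cover relation x ⋖ y on 𝓔 : y = x + s or y = x - k  (i.e. x = y + k)
Cover : ℕ → ℕ → ℕ → ℕ → Set
Cover s k x y = Inℰ s k x × Inℰ s k y × ((y ≡ x + s) ⊎ (x ≡ y + k))

_<ℰ[_,_]_ : ℕ → ℕ → ℕ → ℕ → Set
x <ℰ[ s , k ] y = TransClosure (Cover s k) x y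

{-# OPTIONS --safe #-}
-- Write N = s + k. As gcd(s, N) = 1, s has an inverse t modulo N, and every x < N is
-- (index x)·s mod N for index x = t x mod N. Both kinds of cover, x ↦ x + s and
-- x ↦ x − k, add s modulo N, so a cover raises the index by one: <ℰ is irreflexive.
-- Conversely, if q s mod N = a s + b N is representable then b = 0 and q s ≤ a s < N, so
-- p s is representable for all p ≤ q. Hence ℰ is upward closed in the index, and the
-- elements with index between those of x and y form a chain of covers from x to y.
module Submission where

open import Defs
open import Data.Nat using (ℕ; zero; suc; _+_; _*_; _∸_; _≤_; _<_; z≤n; s≤s; s≤s⁻¹; NonZero; >-nonZero⁻¹)
open import Data.Nat.Properties
open import Data.Nat.DivMod
open import Data.Nat.Coprimality using (Coprime; coprime-Bézout; coprime-+)
import Data.Nat.Coprimality as Coprimality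
open import Data.Nat.GCD using (module Bézout)
open import Data.Nat.Tactic.RingSolver using (solve-∀)
open import Data.Product using (_×_; _,_; proj₁; proj₂; ∃-syntax)
open import Data.Sum using (_⊎_; inj₁; inj₂)
open import Function using (_∘_)
open import Relation.Nullary using (¬_; yes; no; contradiction)
open import Relation.Binary using (tri<; tri≈; tri>)
open import Relation.Binary.PropositionalEquality
open import Relation.Binary.Construct.Closure.Transitive using ([_]; _∷_; _∷ʳ_)

module _ {x y : ℕ} (m d : ℕ) .{{_ : NonZero d}} (x≡y : x % d ≡ y % d) where

  +-congˡ-mod : (m + x) % d ≡ (m + y) % d
  +-congˡ-mod = begin
    (m + x) % d             ≡⟨ %-distribˡ-+ m x d ⟩
    (m % d + x % d) % d     ≡⟨ cong (λ z → (m % d + z) % d) x≡y ⟩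
    (m % d + y % d) % d     ≡⟨ %-distribˡ-+ m y d ⟨
    (m + y) % d             ∎
    where open ≡-Reasoning

  *-congˡ-mod : m * x % d ≡ m * y % d
  *-congˡ-mod = begin
    m * x % d               ≡⟨ %-distribˡ-* m x d ⟩
    m % d * (x % d) % d     ≡⟨ cong (λ z → m % d * z % d) x≡y ⟩
    m % d * (y % d) % d     ≡⟨ %-distribˡ-* m y d ⟨
    m * y % d               ∎
    where open ≡-Reasoning

modular-inverse : ∀ {m} n → Coprime (suc n) m → ∃[ t ] t * m % suc n ≡ 1 % suc n
modular-inverse {m} n coprime with coprime-Bézout coprime
... | Bézout.-+ x y 1+xN≡ym = y , (begin
  y * m % suc n             ≡⟨ cong (_% suc n) 1+xN≡ym ⟨
  (1 + x * suc n) % suc n   ≡⟨ [m+kn]%n≡m%n 1 x (suc n) ⟩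
  1 % suc n                 ∎)
  where open ≡-Reasoning
-- Here y m ≡ −1 and n ≡ −1 modulo n + 1, so n y is an inverse.
... | Bézout.+- x y 1+ym≡xN = n * y , (begin
  n * y * m % suc n                         ≡⟨ [m+kn]%n≡m%n (n * y * m) x (suc n) ⟨
  (n * y * m + x * suc n) % suc n           ≡⟨ cong (λ z → (n * y * m + z) % suc n) 1+ym≡xN ⟨
  (n * y * m + (1 + y * m)) % suc n         ≡⟨ cong (_% suc n) (rearrange n y m) ⟩
  (1 + y * m * suc n) % suc n               ≡⟨ [m+kn]%n≡m%n 1 (y * m) (suc n) ⟩
  1 % suc n                                 ∎)
  where
  open ≡-Reasoning
  rearrange : ∀ n y m → n * y * m + (1 + y * m) ≡ 1 + y * m * suc n
  rearrange = solve-∀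

module Multiples (N s t : ℕ) .{{_ : NonZero N}} (t*s≡1 : t * s % N ≡ 1 % N) where

  multiple : ℕ → ℕ
  multiple q = q * s % N

  index : ℕ → ℕ
  index x = t * x % N

  index<N : ∀ x → index x < N
  index<N x = m%n<n (t * x) N

  index-% : ∀ x → index (x % N) ≡ index x
  index-% x = *-congˡ-mod t N (m%n%n≡m%n x N)

  index-*s : ∀ a → index (a * s) ≡ a % N
  index-*s a = begin
    t * (a * s) % N   ≡⟨ cong (_% N) (rearrange t a s) ⟩
    a * (t * s) % N   ≡⟨ *-congˡ-mod a N t*s≡1 ⟩
    a * 1 % N         ≡⟨ cong (_% N) (*-identityʳ a) ⟩
    a % N             ∎
    where
    open ≡-Reasoning
    rearrange : ∀ t a s → t * (a * s) ≡ a * (t * s)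
    rearrange = solve-∀

  index-multiple : ∀ {q} → q < N → index (multiple q) ≡ q
  index-multiple {q} q<N = trans (index-% (q * s)) (trans (index-*s q) (m<n⇒m%n≡m q<N))

  multiple-index : ∀ {x} → x < N → multiple (index x) ≡ x
  multiple-index {x} x<N = begin
    t * x % N * s % N   ≡⟨ cong (_% N) (*-comm (t * x % N) s) ⟩
    s * (t * x % N) % N ≡⟨ *-congˡ-mod s N (m%n%n≡m%n (t * x) N) ⟩
    s * (t * x) % N     ≡⟨ cong (_% N) (rearrange s t x) ⟩
    t * s * x % N       ≡⟨ cong (_% N) (*-comm (t * s) x) ⟩
    x * (t * s) % N     ≡⟨ *-congˡ-mod x N t*s≡1 ⟩
    x * 1 % N           ≡⟨ cong (_% N) (*-identityʳ x) ⟩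
    x % N               ≡⟨ m<n⇒m%n≡m x<N ⟩
    x                   ∎
    where
    open ≡-Reasoning
    rearrange : ∀ s t x → s * (t * x) ≡ t * s * x
    rearrange = solve-∀

  index-injective : ∀ {x y} → x < N → y < N → index x ≡ index y → x ≡ y
  index-injective x<N y<N eq =
    trans (sym (multiple-index x<N)) (trans (cong multiple eq) (multiple-index y<N))

  index-cong : ∀ {x y} → x % N ≡ y % N → index x ≡ index y
  index-cong = *-congˡ-mod t N

  index-+s : ∀ x → index (x + s) ≡ suc (index x) % N
  index-+s x = begin
    t * (x + s) % N       ≡⟨ cong (_% N) (*-distribˡ-+ t x s) ⟩
    (t * x + t * s) % N   ≡⟨ +-congˡ-mod (t * x) N t*s≡1 ⟩
    (t * x + 1) % N       ≡⟨ cong (_% N) (+-comm (t * x) 1) ⟩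
    (1 + t * x) % N       ≡⟨ +-congˡ-mod 1 N (m%n%n≡m%n (t * x) N) ⟨
    suc (index x) % N     ∎
    where open ≡-Reasoning

  multiple-suc : ∀ q → multiple (suc q) ≡ (multiple q + s) % N
  multiple-suc q = begin
    (s + q * s) % N       ≡⟨ +-congˡ-mod s N (m%n%n≡m%n (q * s) N) ⟨
    (s + multiple q) % N  ≡⟨ cong (_% N) (+-comm s (multiple q)) ⟩
    (multiple q + s) % N  ∎
    where open ≡-Reasoning

module Rotation (s k : ℕ) .{{_ : NonZero (s + k)}} (t : ℕ) (t*s≡1 : t * s % (s + k) ≡ 1 % (s + k)) where

  N : ℕ
  N = s + k

  open Multiples N s t t*s≡1

  Step : ℕ → ℕ → Set
  Step x y = (y ≡ x + s) ⊎ (x ≡ y + k)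

  step-% : ∀ {x y} → Step x y → (x + s) % N ≡ y % N
  step-% (inj₁ refl) = refl
  step-% {y = y} (inj₂ refl) = begin
    (y + k + s) % N     ≡⟨ cong (_% N) (trans (+-assoc y k s) (cong (y +_) (+-comm k s))) ⟩
    (y + N) % N         ≡⟨ [m+n]%n≡m%n y N ⟩
    y % N               ∎
    where open ≡-Reasoning

  step-+s : ∀ {a} → a < N → Step a ((a + s) % N)
  step-+s {a} a<N with a <? k
  ... | yes a<k = inj₁ (m<n⇒m%n≡m (subst (a + s <_) (+-comm k s) (+-monoˡ-< s a<k)))
  ... | no a≮k = inj₂ (begin
    a                   ≡⟨ m∸n+n≡m k≤a ⟨
    a ∸ k + k           ≡⟨ cong (_+ k) wrap ⟨
    (a + s) % N + k     ∎)
    where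
    open ≡-Reasoning
    k≤a : k ≤ a
    k≤a = ≮⇒≥ a≮k
    wrap : (a + s) % N ≡ a ∸ k
    wrap = begin
      (a + s) % N           ≡⟨ cong (λ z → (z + s) % N) (m∸n+n≡m k≤a) ⟨
      (a ∸ k + k + s) % N   ≡⟨ step-% (inj₂ refl) ⟩
      (a ∸ k) % N           ≡⟨ m<n⇒m%n≡m (≤-<-trans (m∸n≤m a k) a<N) ⟩
      a ∸ k                 ∎

  multiple-step : ∀ q → Step (multiple q) (multiple (suc q))
  multiple-step q = subst (Step (multiple q)) (sym (multiple-suc q)) (step-+s (m%n<n (q * s) N))

  index-step : ∀ {x y} → Step x y → index y ≡ suc (index x) % N
  index-step {x} x⋖y = trans (sym (index-cong (step-% x⋖y))) (index-+s x)

  index-zero : index 0 ≡ 0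
  index-zero = trans (cong (_% N) (*-zeroʳ t)) (m<n⇒m%n≡m (>-nonZero⁻¹ N))

  -- The cover y of x cannot wrap around to index 0, because 0 ∉ ℰ.
  cover⇒index-suc : ∀ {x y} → Cover s k x y → index y ≡ suc (index x)
  cover⇒index-suc {x} {y} (_ , ((0<y , _) , y<N) , x⋖y) with m≤n⇒m<n∨m≡n (index<N x)
  ... | inj₁ 1+ix<N = trans (index-step x⋖y) (m<n⇒m%n≡m 1+ix<N)
  ... | inj₂ 1+ix≡N = contradiction y≡0 (>⇒≢ 0<y)
    where
    y≡0 : y ≡ 0
    y≡0 = index-injective y<N (>-nonZero⁻¹ N) (begin
      index y           ≡⟨ index-step x⋖y ⟩
      suc (index x) % N ≡⟨ cong (_% N) 1+ix≡N ⟩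
      N % N             ≡⟨ n%n≡0 N ⟩
      0                 ≡⟨ index-zero ⟨
      index 0           ∎)
      where open ≡-Reasoning

  <ℰ⇒index< : ∀ {x y} → x <ℰ[ s , k ] y → index x < index y
  <ℰ⇒index< [ x⋖y ] = ≤-reflexive (sym (cover⇒index-suc x⋖y))
  <ℰ⇒index< (x⋖y ∷ y<z) = <-trans (<ℰ⇒index< [ x⋖y ]) (<ℰ⇒index< y<z)

  multiple-positive : ∀ {q} → 0 < q → q < N → 0 < multiple q
  multiple-positive {q} 0<q q<N = n≢0⇒n>0 λ multiple≡0 → >⇒≢ 0<q (begin
    q                   ≡⟨ index-multiple q<N ⟨
    index (multiple q)  ≡⟨ cong index multiple≡0 ⟩
    index 0             ≡⟨ index-zero ⟩
    0                   ∎)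
    where open ≡-Reasoning

  inSemigroup-multiple-downwardClosed : ∀ {p q} → p ≤ q → q < N →
    InSemigroup s k (multiple q) → InSemigroup s k (multiple p)
  inSemigroup-multiple-downwardClosed {p} {q} p≤q q<N (a , suc b , eq) =
    contradiction (subst (N ≤_) eq (≤-trans (m≤m+n N (b * N)) (m≤n+m _ (a * s)))) (<⇒≱ (m%n<n (q * s) N))
  inSemigroup-multiple-downwardClosed {p} {q} p≤q q<N (a , zero , eq) =
    p , 0 , trans (+-identityʳ (p * s)) (sym (m<n⇒m%n≡m ps<N))
    where
    as≡multiple : a * s ≡ multiple q
    as≡multiple = trans (sym (+-identityʳ (a * s))) eq
    q≡a%N : q ≡ a % N
    q≡a%N = trans (sym (index-multiple q<N)) (trans (cong index (sym as≡multiple)) (index-*s a))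
    ps<N : p * s < N
    ps<N = begin-strict
      p * s         ≤⟨ *-monoˡ-≤ s (≤-trans p≤q (subst (_≤ a) (sym q≡a%N) (m%n≤m a N))) ⟩
      a * s         ≡⟨ as≡multiple ⟩
      multiple q    <⟨ m%n<n (q * s) N ⟩
      N             ∎
      where open ≤-Reasoning

  multiple-inℰ : ∀ {p q} → p < q → q < N → Inℰ s k (multiple p) → Inℰ s k (multiple q)
  multiple-inℰ {q = q} p<q q<N ((_ , multiple∉S) , _) =
    (multiple-positive (≤-<-trans z≤n p<q) q<N ,
     multiple∉S ∘ inSemigroup-multiple-downwardClosed (<⇒≤ p<q) q<N) ,
    m%n<n (q * s) N

  multiple-cover : ∀ {q} → Inℰ s k (multiple q) → suc q < N → Cover s k (multiple q) (multiple (suc q))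
  multiple-cover {q} q∈ℰ 1+q<N = q∈ℰ , multiple-inℰ (n<1+n q) 1+q<N q∈ℰ , multiple-step q

  multiple-<ℰ : ∀ {p q} → Inℰ s k (multiple p) → p < q → q < N → multiple p <ℰ[ s , k ] multiple q
  multiple-<ℰ {p} {suc q} p∈ℰ p<1+q 1+q<N with m≤n⇒m<n∨m≡n (s≤s⁻¹ p<1+q)
  ... | inj₁ p<q = multiple-<ℰ p∈ℰ p<q q<N ∷ʳ multiple-cover (multiple-inℰ p<q q<N p∈ℰ) 1+q<N
    where
    q<N : q < N
    q<N = <-trans (n<1+n q) 1+q<N
  ... | inj₂ refl = [ multiple-cover p∈ℰ 1+q<N ]

  index<⇒<ℰ : ∀ {x y} → Inℰ s k x → Inℰ s k y → index x < index y → x <ℰ[ s , k ] y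
  index<⇒<ℰ {x} {y} x∈ℰ@(_ , x<N) (_ , y<N) ix<iy =
    subst₂ (_<ℰ[ s , k ]_) (multiple-index x<N) (multiple-index y<N)
      (multiple-<ℰ (subst (Inℰ s k) (sym (multiple-index x<N)) x∈ℰ) ix<iy (index<N y))

  <ℰ-irreflexive : ∀ x → ¬ (x <ℰ[ s , k ] x)
  <ℰ-irreflexive x = <-irrefl refl ∘ <ℰ⇒index<

  <ℰ-total : ∀ {x y} → Inℰ s k x → Inℰ s k y → x ≢ y → (x <ℰ[ s , k ] y) ⊎ (y <ℰ[ s , k ] x)
  <ℰ-total {x} {y} x∈ℰ y∈ℰ x≢y with <-cmp (index x) (index y)
  ... | tri< ix<iy _ _ = inj₁ (index<⇒<ℰ x∈ℰ y∈ℰ ix<iy)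
  ... | tri≈ _ ix≡iy _ = contradiction (index-injective (proj₂ x∈ℰ) (proj₂ y∈ℰ) ix≡iy) x≢y
  ... | tri> _ _ iy<ix = inj₂ (index<⇒<ℰ y∈ℰ x∈ℰ iy<ix)

lemma3p2 : (s k : ℕ) → Coprime s k → 2 ≤ s → 1 ≤ k →
    ((x : ℕ) → Inℰ s k x → ¬ (x <ℰ[ s , k ] x))
    × ((x y : ℕ) → Inℰ s k x → Inℰ s k y → x ≢ y →
    (x <ℰ[ s , k ] y) ⊎ (y <ℰ[ s , k ] x))
lemma3p2 s@(suc (suc s′)) k coprime _ _ =
  (λ x _ → <ℰ-irreflexive x) , (λ _ _ → <ℰ-total)
  where
  inverse : ∃[ t ] t * s % (s + k) ≡ 1 % (s + k)
  inverse = modular-inverse (suc (s′ + k)) (coprime-+ (Coprimality.sym coprime))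
  open Rotation s k (proj₁ inverse) (proj₂ inverse)
lemma3p2 (suc zero) _ _ (s≤s ()) _
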